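{- Let $G \in \mathbb{R}^{N \times N}$ be a real symmetric matrix (weighted undirected graph on vertex set $\{1,\dots,N\}$) with a cospectral pair $\{u,v\}$. Let $p \in \{+1,-1\}$ and let $\mathbb{X}^p_\gamma$ and $\mathbb{Y}^p_\delta$ be (in general non-uniform) walk multiplets of $G$ relative to $\{u,v\}$, both with parity $p$, with real weight tuples $\gamma = (\gamma_x)_{x\in\mathbb{X}}$ and $\delta = (\delta_y)_{y \in \mathbb{Y}}$, and let $\mathbb{Z} = \mathbb{X} \cap \mathbb{Y}$ (possibly nonempty). Define $H \in \mathbb{R}^{N \times N}$ by $$H_{x,y} = H_{y,x} = \begin{cases} G_{x,y} + \gamma_x \delta_y & \text{if } x \notin \mathbb{Z} \text{ or } y \notin \mathbb{Z},\\ G_{x,y} + \gamma_x\delta_y + \gamma_y \delta_x & \text{if } x,y \in \mathbb{Z},\end{cases}\qquad \forall\, x \in \mathbb{X},\ y \in \mathbb{Y},$$ and $H_{i,j} = G_{i,j}$ for all other pairs $(i,j)$. Then $u,v$ are cospectral in $H$, and every walk multiplet of $G$ relative to $\{u,v\}$ with parity $p$ (with its weight tuple) is also a walk multiplet of $H$ relative to $\{u,v\}$ with parity $p$.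
   Context: A real symmetric matrix $H \in \mathbb{R}^{n\times n}$ is identified with an undirected weighted graph on vertices $1,\dots,n$, with edge weight $H_{i,j}$ (diagonal entries are loops). Two vertices $u,v$ are cospectral in $H$ if $[H^k]_{u,u} = [H^k]_{v,v}$ for all integers $k \geq 0$. Given a vertex subset $\mathbb{M}$, a tuple $\gamma = (\gamma_m)_{m\in\mathbb{M}}$ of real numbers, and $p \in \{+1,-1\}$, $\mathbb{M}$ is a walk multiplet $\mathbb{M}_\gamma^p$ of $H$ relative to $u,v$ with parity $p$ if $\sum_{m\in\mathbb{M}}\gamma_m [H^k]_{u,m} = p\sum_{m\in\mathbb{M}}\gamma_m[H^k]_{v,m}$ for all $k\in\{0,\dots,n-1\}$ (equivalently for all integers $k\ge 0$). It is called uniform if all $\gamma_m$ are equal and non-uniform otherwise. -}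

module Defs where

open import Level using (Level)
open import Algebra.Bundles using (CommutativeRing)
open import Data.Nat using (ℕ; zero; suc)
open import Data.Fin using (Fin; zero; suc; _≟_)
open import Data.Fin.Subset using (Subset; _∩_)
open import Data.Fin.Subset.Properties using (_∈?_)
open import Data.Sign using (Sign)
open import Relation.Nullary using (yes; no)
open import Relation.Nullary.Decidable using (_×-dec_)

-- Everything is developed over an arbitrary commutative ring R
-- (the paper works over the reals).
module _ {c ℓ : Level} (R : CommutativeRing c ℓ) where
  open CommutativeRing R using (Carrier; _≈_; _+_; _*_; -_; 0#; 1#)

  Mat : ℕ → Set c
  Mat n = Fin n → Fin n → Carrier

  sumF : ∀ n → (Fin n → Carrier) → Carrier
  sumF zero    f = 0#
  sumF (suc n) f = f zero + sumF n (λ i → f (suc i))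

  idMat : ∀ {n} → Mat n
  idMat i j with i ≟ j
  ... | yes _ = 1#
  ... | no  _ = 0#

  mulMat : ∀ {n} → Mat n → Mat n → Mat n
  mulMat {n} A B i j = sumF n (λ k → A i k * B k j)

  powMat : ∀ {n} → Mat n → ℕ → Mat n
  powMat H zero    = idMat
  powMat H (suc k) = mulMat H (powMat H k)

  SymmetricMat : ∀ {n} → Mat n → Set ℓ
  SymmetricMat H = ∀ i j → H i j ≈ H j i

  Cospectral : ∀ {n} → Mat n → Fin n → Fin n → Set ℓ
  Cospectral H u v = ∀ k → powMat H k u u ≈ powMat H k v v

  parity : Sign → Carrier
  parity Sign.+ = 1#
  parity Sign.- = - 1#

  -- ∑_{m ∈ M} γ_m r_m   (the weight tuple γ is given as a function on all
  -- vertices; only its values on M are used)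
  wsum : ∀ {n} → Subset n → (Fin n → Carrier) → (Fin n → Carrier) → Carrier
  wsum {n} M γ r = sumF n (λ m → term m)
    where
    term : Fin _ → Carrier
    term m with m ∈? M
    ... | yes _ = γ m * r m
    ... | no  _ = 0#

  WalkMultiplet : ∀ {n} → Mat n → Fin n → Fin n → Subset n
                  → (Fin n → Carrier) → Sign → Set ℓ
  WalkMultiplet H u v M γ p =
    ∀ k → wsum M γ (powMat H k u) ≈ parity p * wsum M γ (powMat H k v)

  -- Entry (i,j) is "covered" either as (x,y) = (i,j) (i ∈ X, j ∈ Y) or as
  -- (x,y) = (j,i) (j ∈ X, i ∈ Y); when both apply, i,j ∈ Z and both give the
  -- same value.
  modifiedMat : ∀ {n} → Mat n → Subset n → (Fin n → Carrier)
                → Subset n → (Fin n → Carrier) → Mat n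
  modifiedMat G X γ Y δ i j with (i ∈? X) ×-dec (j ∈? Y)
  ... | yes _ = caseXY i j
    where
    caseXY : Fin _ → Fin _ → Carrier
    caseXY x y with (x ∈? (X ∩ Y)) ×-dec (y ∈? (X ∩ Y))
    ... | yes _ = G x y + γ x * δ y + γ y * δ x
    ... | no  _ = G x y + γ x * δ y
  ... | no _ with (j ∈? X) ×-dec (i ∈? Y)
  ...   | yes _ = caseYX j i
    where
    caseYX : Fin _ → Fin _ → Carrier
    caseYX x y with (x ∈? (X ∩ Y)) ×-dec (y ∈? (X ∩ Y))
    ... | yes _ = G x y + γ x * δ y + γ y * δ x
    ... | no  _ = G x y + γ x * δ y
  ...   | no _ = G i j

-- Write g and d for γ and δ restricted to X and Y; then the modified matrix is the
-- rank-two update H = G + g dᵀ + d gᵀ.  For symmetric G, a weighted vertex set is a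
-- walk multiplet of parity p exactly when its weight vector is orthogonal to every
-- Gᵏ w, where w = e_u − p e_v.  In particular g and d are, so the update vanishes on
-- the whole orbit of w and Hᵏ w = Gᵏ w for all k; hence walk multiplets of G remain
-- walk multiplets of H.  As p² = 1 and Gᵏ is symmetric,
-- [Gᵏ]_uu − [Gᵏ]_vv = ⟨w, Gᵏ (e_u + p e_v)⟩ = ⟨Gᵏ w, e_u + p e_v⟩,
-- so this difference is also the same for G and H, and cospectrality transfers.
module Submission where

open import Defs
open import Level using (Level)
open import Algebra.Bundles using (CommutativeRing)
open import Data.Nat using (ℕ; zero; suc)
open import Data.Fin using (Fin; _≟_; punchIn)
open import Data.Fin.Properties using (punchInᵢ≢i)
open import Data.Fin.Subset using (Subset; _∈_; _∉_; _∩_)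
open import Data.Fin.Subset.Properties using (_∈?_; x∈p∩q⁺; x∈p∩q⁻)
open import Data.Sign using (Sign)
open import Data.Product using (_×_; _,_; proj₁; proj₂)
open import Data.Vec.Functional using (Vector)
open import Data.Empty using (⊥-elim)
open import Relation.Nullary using (yes; no; ¬_)
open import Relation.Nullary.Decidable using (_×-dec_)
open import Relation.Binary.PropositionalEquality as ≡ using (_≡_; _≢_)

module WalkMultiplets {c ℓ : Level} (R : CommutativeRing c ℓ) where
  open CommutativeRing R
  open import Algebra.Properties.Semiring.Sum semiring
    using (sum; sum-cong-≋; ∑-distrib-+; *-distribˡ-sum; *-distribʳ-sum; ∑-comm;
           sum-remove; sum-replicate-zero)
  open import Algebra.Properties.Ring ring using (-‿distribˡ-*; -1*x≈-x)
  open import Algebra.Properties.Group +-group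
    using (x∙y⁻¹≈ε⇒x≈y; x≈y⇒x∙y⁻¹≈ε; ⁻¹-involutive)
  open import Algebra.Properties.CommutativeSemigroup *-commutativeSemigroup
    using (x∙yz≈y∙xz)
  open import Data.Vec.Functional.Relation.Binary.Equality.Setoid setoid
    using (_≋_; ≋-refl; ≋-trans)
  open import Relation.Binary.Reasoning.Setoid setoid

  x≈0⇒y+x≈y : ∀ {x} y → x ≈ 0# → y + x ≈ y
  x≈0⇒y+x≈y y x≈0 = trans (+-congˡ x≈0) (+-identityʳ y)

  x≈0⇒y*x≈0 : ∀ {x} y → x ≈ 0# → y * x ≈ 0#
  x≈0⇒y*x≈0 y x≈0 = trans (*-congˡ x≈0) (zeroʳ y)

  sumF≡sum : ∀ n (f : Vector Carrier n) → sumF R n f ≡ sum f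
  sumF≡sum zero    f = ≡.refl
  sumF≡sum (suc n) f = ≡.cong (f Fin.zero +_) (sumF≡sum n (λ i → f (Fin.suc i)))

  infixl 7 _·_
  infixl 6 _+⟨_⟩_
  infixr 5 _*ᵥ_ _^[_]*ᵥ_
  infix  4 _≈ₘ_

  _·_ : ∀ {n} → Vector Carrier n → Vector Carrier n → Carrier
  x · y = sum λ i → x i * y i

  _+⟨_⟩_ : ∀ {n} → Vector Carrier n → Carrier → Vector Carrier n → Vector Carrier n
  (x +⟨ a ⟩ y) i = x i + a * y i

  e : ∀ {n} → Fin n → Vector Carrier n
  e a i = idMat R i a

  _*ᵥ_ : ∀ {n} → Mat R n → Vector Carrier n → Vector Carrier n
  (A *ᵥ x) i = A i · x

  _^[_]*ᵥ_ : ∀ {n} → Mat R n → ℕ → Vector Carrier n → Vector Carrier n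
  A ^[ zero  ]*ᵥ x = x
  A ^[ suc k ]*ᵥ x = A *ᵥ (A ^[ k ]*ᵥ x)

  _≈ₘ_ : ∀ {n} → Mat R n → Mat R n → Set ℓ
  A ≈ₘ B = ∀ i j → A i j ≈ B i j

  ·-cong : ∀ {n} {x x′ y y′ : Vector Carrier n} → x ≋ x′ → y ≋ y′ → x · y ≈ x′ · y′
  ·-cong x≋x′ y≋y′ = sum-cong-≋ λ i → *-cong (x≋x′ i) (y≋y′ i)

  ·-comm : ∀ {n} (x y : Vector Carrier n) → x · y ≈ y · x
  ·-comm x y = sum-cong-≋ λ i → *-comm (x i) (y i)

  ·-linearʳ : ∀ {n} (x y z : Vector Carrier n) a → x · (y +⟨ a ⟩ z) ≈ x · y + a * (x · z)
  ·-linearʳ x y z a = begin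
    sum (λ i → x i * (y i + a * z i))        ≈⟨ sum-cong-≋ (λ i → distribˡ (x i) _ _) ⟩
    sum (λ i → x i * y i + x i * (a * z i))  ≈⟨ ∑-distrib-+ (λ i → x i * y i) _ ⟩
    x · y + sum (λ i → x i * (a * z i))      ≈⟨ +-congˡ (sum-cong-≋ λ i → x∙yz≈y∙xz (x i) a (z i)) ⟩
    x · y + sum (λ i → a * (x i * z i))      ≈⟨ +-congˡ (*-distribˡ-sum a (λ i → x i * z i)) ⟨
    x · y + a * (x · z)                      ∎

  ·-linearˡ : ∀ {n} (x y z : Vector Carrier n) a → (x +⟨ a ⟩ y) · z ≈ x · z + a * (y · z)
  ·-linearˡ x y z a = begin
    (x +⟨ a ⟩ y) · z     ≈⟨ ·-comm _ z ⟩
    z · (x +⟨ a ⟩ y)     ≈⟨ ·-linearʳ z x y a ⟩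
    z · x + a * (z · y)  ≈⟨ +-cong (·-comm z x) (*-congˡ (·-comm z y)) ⟩
    x · z + a * (y · z)  ∎

  e-diag : ∀ {n} (a : Fin n) → e a a ≈ 1#
  e-diag a with a ≟ a
  ... | yes _   = refl
  ... | no a≢a = ⊥-elim (a≢a ≡.refl)

  e-offdiag : ∀ {n} {a i : Fin n} → i ≢ a → e a i ≈ 0#
  e-offdiag {a = a} {i} i≢a with i ≟ a
  ... | yes i≡a = ⊥-elim (i≢a i≡a)
  ... | no _    = refl

  ·-eʳ : ∀ {n} (x : Vector Carrier n) a → x · e a ≈ x a
  ·-eʳ {suc n} x a = begin
    x · e a                                                       ≈⟨ sum-remove {i = a} (λ j → x j * e a j) ⟩
    x a * e a a + sum (λ j → x (punchIn a j) * e a (punchIn a j))  ≈⟨ +-cong diag offdiag ⟩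
    x a + 0#                                                      ≈⟨ +-identityʳ (x a) ⟩
    x a                                                           ∎
    where
    diag : x a * e a a ≈ x a
    diag = trans (*-congˡ (e-diag a)) (*-identityʳ (x a))
    offdiag : sum (λ j → x (punchIn a j) * e a (punchIn a j)) ≈ 0#
    offdiag = trans (sum-cong-≋ λ j → x≈0⇒y*x≈0 _ (e-offdiag (punchInᵢ≢i a j)))
                    (sum-replicate-zero n)

  ·-eˡ : ∀ {n} (x : Vector Carrier n) a → e a · x ≈ x a
  ·-eˡ x a = trans (·-comm (e a) x) (·-eʳ x a)

  *ᵥ-cong : ∀ {n} (A : Mat R n) {x y : Vector Carrier n} → x ≋ y → A *ᵥ x ≋ A *ᵥ y
  *ᵥ-cong A x≋y i = ·-cong ≋-refl x≋y

  ^-congₘ : ∀ {n} {A B : Mat R n} → A ≈ₘ B → ∀ k {x} → A ^[ k ]*ᵥ x ≋ B ^[ k ]*ᵥ x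
  ^-congₘ A≈B zero    = ≋-refl
  ^-congₘ A≈B (suc k) i = ·-cong (A≈B i) (^-congₘ A≈B k)

  ^-linear : ∀ {n} (A : Mat R n) k (x y : Vector Carrier n) a →
             A ^[ k ]*ᵥ (x +⟨ a ⟩ y) ≋ (A ^[ k ]*ᵥ x) +⟨ a ⟩ (A ^[ k ]*ᵥ y)
  ^-linear A zero    x y a = ≋-refl
  ^-linear A (suc k) x y a i =
    trans (*ᵥ-cong A (^-linear A k x y a) i) (·-linearʳ (A i) _ _ a)

  ^-*ᵥ-comm : ∀ {n} (A : Mat R n) k (x : Vector Carrier n) →
              A ^[ k ]*ᵥ (A *ᵥ x) ≋ A *ᵥ (A ^[ k ]*ᵥ x)
  ^-*ᵥ-comm A zero    x = ≋-refl
  ^-*ᵥ-comm A (suc k) x = *ᵥ-cong A (^-*ᵥ-comm A k x)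

  powMat≈column : ∀ {n} (A : Mat R n) k i a → powMat R A k i a ≈ (A ^[ k ]*ᵥ e a) i
  powMat≈column         A zero    i a = refl
  powMat≈column {n = n} A (suc k) i a =
    trans (reflexive (sumF≡sum n _)) (sum-cong-≋ λ j → *-congˡ (powMat≈column A k j a))

  *ᵥ-selfAdjoint : ∀ {n} {A : Mat R n} → SymmetricMat R A →
                   ∀ x y → x · (A *ᵥ y) ≈ (A *ᵥ x) · y
  *ᵥ-selfAdjoint {A = A} symA x y = begin
    sum (λ i → x i * sum (λ j → A i j * y j))      ≈⟨ sum-cong-≋ (λ i → *-distribˡ-sum (x i) (λ j → A i j * y j)) ⟩
    sum (λ i → sum (λ j → x i * (A i j * y j)))    ≈⟨ ∑-comm (λ i j → x i * (A i j * y j)) ⟩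
    sum (λ j → sum (λ i → x i * (A i j * y j)))    ≈⟨ sum-cong-≋ (λ j → sum-cong-≋ (λ i → regroup i j)) ⟩
    sum (λ j → sum (λ i → (A j i * x i) * y j))    ≈⟨ sum-cong-≋ (λ j → *-distribʳ-sum (y j) (λ i → A j i * x i)) ⟨
    sum (λ j → sum (λ i → A j i * x i) * y j)      ∎
    where
    regroup : ∀ i j → x i * (A i j * y j) ≈ (A j i * x i) * y j
    regroup i j = trans (sym (*-assoc _ _ _))
                        (*-congʳ (trans (*-comm _ _) (*-congʳ (symA i j))))

  ^-selfAdjoint : ∀ {n} {A : Mat R n} → SymmetricMat R A →
                  ∀ k x y → x · (A ^[ k ]*ᵥ y) ≈ (A ^[ k ]*ᵥ x) · y
  ^-selfAdjoint         symA zero    x y = refl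
  ^-selfAdjoint {A = A} symA (suc k) x y = begin
    x · (A *ᵥ (A ^[ k ]*ᵥ y))    ≈⟨ *ᵥ-selfAdjoint symA x _ ⟩
    (A *ᵥ x) · (A ^[ k ]*ᵥ y)    ≈⟨ ^-selfAdjoint symA k _ y ⟩
    (A ^[ k ]*ᵥ (A *ᵥ x)) · y    ≈⟨ ·-cong (^-*ᵥ-comm A k x) ≋-refl ⟩
    (A *ᵥ (A ^[ k ]*ᵥ x)) · y    ∎

  ^-basis-symmetric : ∀ {n} {A : Mat R n} → SymmetricMat R A →
                      ∀ k a b → (A ^[ k ]*ᵥ e a) b ≈ (A ^[ k ]*ᵥ e b) a
  ^-basis-symmetric {A = A} symA k a b = begin
    (A ^[ k ]*ᵥ e a) b        ≈⟨ ·-eʳ _ b ⟨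
    (A ^[ k ]*ᵥ e a) · e b    ≈⟨ ^-selfAdjoint symA k (e a) (e b) ⟨
    e a · (A ^[ k ]*ᵥ e b)    ≈⟨ ·-eˡ _ a ⟩
    (A ^[ k ]*ᵥ e b) a        ∎

  powMat≈row : ∀ {n} {A : Mat R n} → SymmetricMat R A →
               ∀ k a b → powMat R A k a b ≈ (A ^[ k ]*ᵥ e a) b
  powMat≈row {A = A} symA k a b =
    trans (powMat≈column A k a b) (^-basis-symmetric symA k b a)

  SymmetricMat-resp-≈ₘ : ∀ {n} {A B : Mat R n} → A ≈ₘ B → SymmetricMat R B → SymmetricMat R A
  SymmetricMat-resp-≈ₘ A≈B symB i j = trans (A≈B i j) (trans (symB i j) (sym (A≈B j i)))

  rankTwoUpdate : ∀ {n} → Mat R n → Vector Carrier n → Vector Carrier n → Mat R n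
  rankTwoUpdate B g d i j = B i j + g i * d j + d i * g j

  rankTwoUpdate-symmetric : ∀ {n} {B : Mat R n} {g d} → SymmetricMat R B →
                            SymmetricMat R (rankTwoUpdate B g d)
  rankTwoUpdate-symmetric {g = g} {d} symB i j =
    trans (+-assoc _ _ _)
      (trans (+-cong (symB i j) (trans (+-comm _ _) (+-cong (*-comm (d i) (g j)) (*-comm (g i) (d j)))))
        (sym (+-assoc _ _ _)))

  rankTwoUpdate-*ᵥ : ∀ {n} (B : Mat R n) g d x i →
                     (rankTwoUpdate B g d *ᵥ x) i ≈ (B *ᵥ x) i + g i * (d · x) + d i * (g · x)
  rankTwoUpdate-*ᵥ B g d x i =
    trans (·-linearˡ (B i +⟨ g i ⟩ d) g x (d i)) (+-congʳ (·-linearˡ (B i) d x (g i)))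

  SameOrbit : ∀ {n} → Mat R n → Mat R n → Vector Carrier n → Set ℓ
  SameOrbit A B w = ∀ k → A ^[ k ]*ᵥ w ≋ B ^[ k ]*ᵥ w

  OrthogonalToOrbit : ∀ {n} → Mat R n → Vector Carrier n → Vector Carrier n → Set ℓ
  OrthogonalToOrbit A w g = ∀ k → g · (A ^[ k ]*ᵥ w) ≈ 0#

  rankTwoUpdate-fixes-orbit : ∀ {n} {B : Mat R n} {w g d} →
                              OrthogonalToOrbit B w g → OrthogonalToOrbit B w d →
                              SameOrbit (rankTwoUpdate B g d) B w
  rankTwoUpdate-fixes-orbit g⊥ d⊥ zero = ≋-refl
  rankTwoUpdate-fixes-orbit {B = B} {w} {g} {d} g⊥ d⊥ (suc k) i = begin
    (A *ᵥ (A ^[ k ]*ᵥ w)) i                           ≈⟨ *ᵥ-cong A (rankTwoUpdate-fixes-orbit g⊥ d⊥ k) i ⟩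
    (A *ᵥ Bᵏw) i                                      ≈⟨ rankTwoUpdate-*ᵥ B g d Bᵏw i ⟩
    (B *ᵥ Bᵏw) i + g i * (d · Bᵏw) + d i * (g · Bᵏw)  ≈⟨ +-congʳ (x≈0⇒y+x≈y _ (x≈0⇒y*x≈0 (g i) (d⊥ k))) ⟩
    (B *ᵥ Bᵏw) i + d i * (g · Bᵏw)                    ≈⟨ x≈0⇒y+x≈y _ (x≈0⇒y*x≈0 (d i) (g⊥ k)) ⟩
    (B *ᵥ Bᵏw) i                                      ∎
    where
    A : Mat R _
    A = rankTwoUpdate B g d
    Bᵏw : Vector Carrier _
    Bᵏw = B ^[ k ]*ᵥ w

  mask : ∀ {n} → Subset n → Vector Carrier n → Vector Carrier n
  mask M ε m with m ∈? M
  ... | yes _ = ε m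
  ... | no  _ = 0#

  mask-∈ : ∀ {n} {M : Subset n} {m} ε → m ∈ M → mask M ε m ≈ ε m
  mask-∈ {M = M} {m} ε m∈M with m ∈? M
  ... | yes _   = refl
  ... | no m∉M = ⊥-elim (m∉M m∈M)

  mask-∉ : ∀ {n} {M : Subset n} {m} ε → m ∉ M → mask M ε m ≈ 0#
  mask-∉ {M = M} {m} ε m∉M with m ∈? M
  ... | yes m∈M = ⊥-elim (m∉M m∈M)
  ... | no _    = refl

  mask*mask≈0 : ∀ {n} {A B : Subset n} α β {i j} → ¬ (i ∈ A × j ∈ B) →
                mask A α i * mask B β j ≈ 0#
  mask*mask≈0 {A = A} α β {i} ¬i∈A×j∈B with i ∈? A
  ... | yes i∈A = x≈0⇒y*x≈0 _ (mask-∉ β λ j∈B → ¬i∈A×j∈B (i∈A , j∈B))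
  ... | no _    = zeroˡ _

  mask*mask≈ : ∀ {n} {A B : Subset n} α β {i j} → i ∈ A → j ∈ B →
               mask A α i * mask B β j ≈ α i * β j
  mask*mask≈ α β i∈A j∈B = *-cong (mask-∈ α i∈A) (mask-∈ β j∈B)

  -- The summand of wsum is local to its definition, so it can only be referred to
  -- through a metavariable, solved by the use in wsum≈mask·.
  wsum-summand≈ : ∀ {n} (M : Subset n) ε r m → _ ≈ mask M ε m * r m

  wsum≈mask· : ∀ {n} (M : Subset n) ε r → wsum R M ε r ≈ mask M ε · r
  wsum≈mask· {n} M ε r = trans (reflexive (sumF≡sum n _)) (sum-cong-≋ (wsum-summand≈ M ε r))

  wsum-summand≈ M ε r m with m ∈? M
  ... | yes _ = refl
  ... | no  _ = sym (zeroˡ (r m))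

  parity*parity : ∀ p → parity R p * parity R p ≈ 1#
  parity*parity Sign.+ = *-identityˡ 1#
  parity*parity Sign.- = trans (-1*x≈-x (- 1#)) (⁻¹-involutive 1#)

  mask·walk : ∀ {n} {A : Mat R n} → SymmetricMat R A → ∀ {u v} M ε k a →
              mask M ε · (A ^[ k ]*ᵥ (e u +⟨ a ⟩ e v))
                ≈ wsum R M ε (powMat R A k u) + a * wsum R M ε (powMat R A k v)
  mask·walk {A = A} symA {u} {v} M ε k a = begin
    mask M ε · (A ^[ k ]*ᵥ (e u +⟨ a ⟩ e v))
      ≈⟨ ·-cong ≋-refl (^-linear A k (e u) (e v) a) ⟩
    mask M ε · ((A ^[ k ]*ᵥ e u) +⟨ a ⟩ (A ^[ k ]*ᵥ e v))
      ≈⟨ ·-linearʳ (mask M ε) _ _ a ⟩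
    mask M ε · (A ^[ k ]*ᵥ e u) + a * (mask M ε · (A ^[ k ]*ᵥ e v))
      ≈⟨ +-cong (rowSum u) (*-congˡ (rowSum v)) ⟨
    wsum R M ε (powMat R A k u) + a * wsum R M ε (powMat R A k v) ∎
    where
    rowSum : ∀ b → wsum R M ε (powMat R A k b) ≈ mask M ε · (A ^[ k ]*ᵥ e b)
    rowSum b = trans (wsum≈mask· M ε _) (·-cong ≋-refl (powMat≈row symA k b))

  walkMultiplet⇒orthogonal : ∀ {n} {A : Mat R n} → SymmetricMat R A → ∀ p {u v M ε} →
                             WalkMultiplet R A u v M ε p →
                             OrthogonalToOrbit A (e u +⟨ - parity R p ⟩ e v) (mask M ε)
  walkMultiplet⇒orthogonal symA p {M = M} {ε} walk k =
    trans (mask·walk symA M ε k _)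
      (trans (+-congˡ (sym (-‿distribˡ-* (parity R p) _))) (x≈y⇒x∙y⁻¹≈ε (walk k)))

  orthogonal⇒walkMultiplet : ∀ {n} {A : Mat R n} → SymmetricMat R A → ∀ p {u v M ε} →
                             OrthogonalToOrbit A (e u +⟨ - parity R p ⟩ e v) (mask M ε) →
                             WalkMultiplet R A u v M ε p
  orthogonal⇒walkMultiplet symA p {M = M} {ε} ⊥orbit k =
    x∙y⁻¹≈ε⇒x≈y _ _
      (trans (+-congˡ (-‿distribˡ-* (parity R p) _))
        (trans (sym (mask·walk symA M ε k _)) (⊥orbit k)))

  involution-cancel : ∀ {π} → π * π ≈ 1# → ∀ a b d → (a + π * b) + - π * (b + π * d) ≈ a + - d
  involution-cancel {π} π²≈1 a b d = begin
    (a + π * b) + - π * (b + π * d)          ≈⟨ +-congˡ (distribˡ (- π) b (π * d)) ⟩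
    (a + π * b) + (- π * b + - π * (π * d))  ≈⟨ +-congˡ (+-cong (-‿distribˡ-* π b) -ππd≈-d) ⟨
    (a + π * b) + (- (π * b) + - d)          ≈⟨ +-assoc _ _ _ ⟩
    a + (π * b + (- (π * b) + - d))          ≈⟨ +-congˡ (+-assoc _ _ _) ⟨
    a + ((π * b + - (π * b)) + - d)          ≈⟨ +-congˡ (trans (+-congʳ (-‿inverseʳ _)) (+-identityˡ _)) ⟩
    a + - d                                  ∎
    where
    ππd≈d : π * (π * d) ≈ d
    ππd≈d = trans (sym (*-assoc π π d)) (trans (*-congʳ π²≈1) (*-identityˡ d))
    -ππd≈-d : - d ≈ - π * (π * d)
    -ππd≈-d = trans (-‿cong (sym ππd≈d)) (-‿distribˡ-* π (π * d))

  diagonal-difference : ∀ {n} {A : Mat R n} → SymmetricMat R A → ∀ {π} → π * π ≈ 1# →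
                        ∀ k u v → (A ^[ k ]*ᵥ e u) u + - (A ^[ k ]*ᵥ e v) v
                                    ≈ (e u +⟨ - π ⟩ e v) · (A ^[ k ]*ᵥ (e u +⟨ π ⟩ e v))
  diagonal-difference {A = A} symA {π} π²≈1 k u v = begin
    U u + - V v                                      ≈⟨ involution-cancel π²≈1 (U u) (V u) (V v) ⟨
    (U u + π * V u) + - π * (V u + π * V v)          ≈⟨ +-congˡ (*-congˡ (+-congʳ (^-basis-symmetric symA k u v))) ⟨
    (U u + π * V u) + - π * (U v + π * V v)          ≈⟨ +-cong (·-eˡ _ u) (*-congˡ (·-eˡ _ v)) ⟨
    e u · (U +⟨ π ⟩ V) + - π * (e v · (U +⟨ π ⟩ V))  ≈⟨ ·-linearˡ (e u) (e v) _ (- π) ⟨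
    (e u +⟨ - π ⟩ e v) · (U +⟨ π ⟩ V)                ≈⟨ ·-cong ≋-refl (^-linear A k (e u) (e v) π) ⟨
    (e u +⟨ - π ⟩ e v) · (A ^[ k ]*ᵥ (e u +⟨ π ⟩ e v)) ∎
    where
    U V : Vector Carrier _
    U = A ^[ k ]*ᵥ e u
    V = A ^[ k ]*ᵥ e v

  cospectral-transfer : ∀ {n} {A B : Mat R n} → SymmetricMat R A → SymmetricMat R B →
                        ∀ {π u v} → π * π ≈ 1# →
                        SameOrbit A B (e u +⟨ - π ⟩ e v) →
                        Cospectral R B u v → Cospectral R A u v
  cospectral-transfer {A = A} {B} symA symB {π} {u} {v} π²≈1 same-orbit cospB k = begin
    powMat R A k u u      ≈⟨ powMat≈column A k u u ⟩
    (A ^[ k ]*ᵥ e u) u    ≈⟨ x∙y⁻¹≈ε⇒x≈y _ _ gapA≈0 ⟩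
    (A ^[ k ]*ᵥ e v) v    ≈⟨ powMat≈column A k v v ⟨
    powMat R A k v v      ∎
    where
    w s : Vector Carrier _
    w = e u +⟨ - π ⟩ e v
    s = e u +⟨ π ⟩ e v
    gapB≈0 : (B ^[ k ]*ᵥ e u) u + - (B ^[ k ]*ᵥ e v) v ≈ 0#
    gapB≈0 = x≈y⇒x∙y⁻¹≈ε
      (trans (sym (powMat≈column B k u u)) (trans (cospB k) (powMat≈column B k v v)))
    gapA≈0 : (A ^[ k ]*ᵥ e u) u + - (A ^[ k ]*ᵥ e v) v ≈ 0#
    gapA≈0 = begin
      (A ^[ k ]*ᵥ e u) u + - (A ^[ k ]*ᵥ e v) v  ≈⟨ diagonal-difference symA π²≈1 k u v ⟩
      w · (A ^[ k ]*ᵥ s)                         ≈⟨ ^-selfAdjoint symA k w s ⟩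
      (A ^[ k ]*ᵥ w) · s                         ≈⟨ ·-cong (same-orbit k) ≋-refl ⟩
      (B ^[ k ]*ᵥ w) · s                         ≈⟨ ^-selfAdjoint symB k w s ⟨
      w · (B ^[ k ]*ᵥ s)                         ≈⟨ diagonal-difference symB π²≈1 k u v ⟨
      (B ^[ k ]*ᵥ e u) u + - (B ^[ k ]*ᵥ e v) v  ≈⟨ gapB≈0 ⟩
      0#                                         ∎

  modifiedMat≈rankTwoUpdate : ∀ {n} {G : Mat R n} → SymmetricMat R G → ∀ X γ Y δ →
                              modifiedMat R G X γ Y δ ≈ₘ rankTwoUpdate G (mask X γ) (mask Y δ)
  modifiedMat≈rankTwoUpdate symG X γ Y δ i j with (i ∈? X) ×-dec (j ∈? Y)
  ... | yes (i∈X , j∈Y) with (i ∈? (X ∩ Y)) ×-dec (j ∈? (X ∩ Y))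
  ...   | yes (i∈Z , j∈Z) =
          +-cong (+-congˡ (sym (mask*mask≈ γ δ i∈X j∈Y)))
                 (trans (*-comm _ _)
                        (sym (mask*mask≈ δ γ (proj₂ (x∈p∩q⁻ X Y i∈Z)) (proj₁ (x∈p∩q⁻ X Y j∈Z)))))
  ...   | no ¬i,j∈Z =
          sym (trans (x≈0⇒y+x≈y _ (mask*mask≈0 δ γ λ (i∈Y , j∈X) →
                                     ¬i,j∈Z (x∈p∩q⁺ (i∈X , i∈Y) , x∈p∩q⁺ (j∈X , j∈Y))))
                     (+-congˡ (mask*mask≈ γ δ i∈X j∈Y)))
  modifiedMat≈rankTwoUpdate symG X γ Y δ i j | no ¬i∈X×j∈Y with (j ∈? X) ×-dec (i ∈? Y)
  ...   | yes (j∈X , i∈Y) with (j ∈? (X ∩ Y)) ×-dec (i ∈? (X ∩ Y))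
  ...     | yes (j∈Z , i∈Z) =
          ⊥-elim (¬i∈X×j∈Y (proj₁ (x∈p∩q⁻ X Y i∈Z) , proj₂ (x∈p∩q⁻ X Y j∈Z)))
  ...     | no _ =
          sym (trans (+-cong (x≈0⇒y+x≈y _ (mask*mask≈0 γ δ ¬i∈X×j∈Y)) (mask*mask≈ δ γ i∈Y j∈X))
                     (+-cong (symG i j) (*-comm _ _)))
  modifiedMat≈rankTwoUpdate symG X γ Y δ i j | no ¬i∈X×j∈Y | no ¬j∈X×i∈Y =
          sym (trans (x≈0⇒y+x≈y _ (mask*mask≈0 δ γ λ (i∈Y , j∈X) → ¬j∈X×i∈Y (j∈X , i∈Y)))
                     (x≈0⇒y+x≈y _ (mask*mask≈0 γ δ ¬i∈X×j∈Y)))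

  modifiedMat-symmetric : ∀ {n} {G : Mat R n} → SymmetricMat R G → ∀ X γ Y δ →
                          SymmetricMat R (modifiedMat R G X γ Y δ)
  modifiedMat-symmetric symG X γ Y δ =
    SymmetricMat-resp-≈ₘ (modifiedMat≈rankTwoUpdate symG X γ Y δ) (rankTwoUpdate-symmetric symG)

  modifiedMat-fixes-orbit : ∀ {n} {G : Mat R n} → SymmetricMat R G → ∀ p {u v X γ Y δ} →
                            WalkMultiplet R G u v X γ p → WalkMultiplet R G u v Y δ p →
                            SameOrbit (modifiedMat R G X γ Y δ) G (e u +⟨ - parity R p ⟩ e v)
  modifiedMat-fixes-orbit symG p {X = X} {γ} {Y} {δ} walkX walkY k =
    ≋-trans (^-congₘ (modifiedMat≈rankTwoUpdate symG X γ Y δ) k)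
            (rankTwoUpdate-fixes-orbit (walkMultiplet⇒orthogonal symG p walkX)
                                       (walkMultiplet⇒orthogonal symG p walkY) k)

  walkMultiplet-transfer : ∀ {n} {A B : Mat R n} → SymmetricMat R A → SymmetricMat R B →
                           ∀ p {u v} →
                           SameOrbit A B (e u +⟨ - parity R p ⟩ e v) →
                           ∀ {M ε} → WalkMultiplet R B u v M ε p → WalkMultiplet R A u v M ε p
  walkMultiplet-transfer symA symB p same-orbit walkB =
    orthogonal⇒walkMultiplet symA p λ k →
      trans (·-cong ≋-refl (same-orbit k)) (walkMultiplet⇒orthogonal symB p walkB k)

theorem2 : ∀ {c ℓ : Level} (R : CommutativeRing c ℓ) (N : ℕ)
    (G : Mat R N) (u v : Fin N) (p : Sign)
    (X Y : Subset N) (γ δ : Fin N → CommutativeRing.Carrier R) →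
    SymmetricMat R G →
    u ≢ v →
    Cospectral R G u v →
    WalkMultiplet R G u v X γ p →
    WalkMultiplet R G u v Y δ p →
    Cospectral R (modifiedMat R G X γ Y δ) u v
      × (∀ (M : Subset N) (ε : Fin N → CommutativeRing.Carrier R) →
           WalkMultiplet R G u v M ε p →
           WalkMultiplet R (modifiedMat R G X γ Y δ) u v M ε p)
theorem2 R N G u v p X Y γ δ symG _ cospG walkX walkY =
    cospectral-transfer symH symG (parity*parity p) same-orbit cospG
  , λ M ε → walkMultiplet-transfer symH symG p same-orbit
  where
  open CommutativeRing R using (-_)
  open WalkMultiplets R
  symH : SymmetricMat R (modifiedMat R G X γ Y δ)
  symH = modifiedMat-symmetric symG X γ Y δ
  same-orbit : SameOrbit (modifiedMat R G X γ Y δ) G (e u +⟨ - parity R p ⟩ e v)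
  same-orbit = modifiedMat-fixes-orbit symG p walkX walkY
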